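{- Let $r\ge1$ and $\mathbb A=\{1,\dots,r\}$. Every commutation relation of the reduction system $SR$ holds modulo the ideal $\mathcal I(SH)$. That is, for all $x>y$ in $\mathbb A$ and all $a\in\mathbb A$, $$\binom{xy}{aa}-\binom{yx}{aa}\in\mathcal I(SH),$$ and for all $x>y$ and $a>b$ in $\mathbb A$, $$\binom{xy}{ab}-\binom{yx}{ba}-\binom{yx}{ab}+\binom{xy}{ba}\in\mathcal I(SH).$$ Hence $\mathcal I(SR)\subseteq\mathcal I(SH)$, and the quotient $\mathcal U(SH)$ (the contextual algebra) is a subalgebra of the $1$-right quantum algebra $\mathcal U(SR)$ in this sense.
   Context: A biword on $\mathbb A$ is a $2\times n$ matrix $\binom{x_1\cdots x_n}{a_1\cdots a_n}$ with entries in $\mathbb A$, viewed as a word in biletters $\binom{x_i}{a_i}$ and multiplied by concatenation. We work in the algebra of (formal) linear combinations of biwords with coefficients in $\mathbb Z[q,q^{ -1}]$. The system $SR$ consists of the relations - $\binom{xy}{aa}=\binom{yx}{aa}$ for $x>y$; - $\binom{xy}{ab}=\binom{yx}{ba}+\binom{yx}{ab}-\binom{xy}{ba}$ for $x>y$ and $a>b$. Let $V(x,y,a,b)=(a-x-\tfrac12)(a-y-\tfrac12)(b-x-\tfrac12)(b-y-\tfrac12)$, which is never $0$. The system $SH$ consists of the relations, for all $x>y$ and all $a,b\in\mathbb A$: - $\binom{xy}{ab}=\binom{yx}{ab}$ if $V(x,y,a,b)>0$; - $\binom{xy}{ab}=\binom{yx}{ba}$ if $V(x,y,a,b)<0$.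 For a system $S$, $\mathcal I(S)$ is the two-sided ideal generated by the differences left side minus right side of its relations, and $\mathcal U(S)$ is the quotient of the algebra by $\mathcal I(S)$. -}

module Defs where

open import Data.Nat using (ℕ)
open import Data.Fin using (Fin; toℕ; _<_)
open import Data.Fin.Properties using () renaming (_≟_ to _≟F_)
open import Data.Integer as ℤ using (ℤ; +_; -_; _-_; _*_; _+_; 0ℤ; 1ℤ)
open import Data.Integer.Properties using () renaming (_≟_ to _≟ℤ_)
open import Data.List using (List; []; _∷_; _++_; map; concatMap)
open import Data.List.Properties using () renaming (≡-dec to ≡-decL)
open import Data.List.Relation.Unary.All using (All)
open import Data.Product using (Σ; ∃; _×_; _,_; proj₁; proj₂)
open import Data.Product.Properties using () renaming (≡-dec to ≡-dec×)
open import Data.Sum using (_⊎_)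
open import Relation.Binary.PropositionalEquality using (_≡_)
open import Relation.Nullary using (yes; no)
open import Relation.Binary.Definitions using (DecidableEquality)

-- The alphabet 𝔸 = {1,…,r} is represented by Fin r (letter i ↦ toℕ i + 1).
-- A biletter (x over a) is the pair (x , a); a biword is a list of biletters.
Biletter : ℕ → Set
Biletter r = Fin r × Fin r

Biword : ℕ → Set
Biword r = List (Biletter r)

_≟W_ : ∀ {r} → DecidableEquality (Biword r)
_≟W_ = ≡-decL (≡-dec× _≟F_ _≟F_)

bw : ∀ {r} → Fin r → Fin r → Fin r → Fin r → Biword r
bw x y a b = (x , a) ∷ (y , b) ∷ []

ZComb : ℕ → Set
ZComb r = List (ℤ × Biword r)

-- Laurent polynomials in ℤ[q,q⁻¹] as formal sums of monomials c·q^e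
Laurent : Set
Laurent = List (ℤ × ℤ)

-- Elements of the algebra of ℤ[q,q⁻¹]-linear combinations of biwords,
-- as formal sums of terms c·q^e·w
Elem : ℕ → Set
Elem r = List (ℤ × ℤ × Biword r)

coeff : ∀ {r} → Elem r → ℤ → Biword r → ℤ
coeff [] e w = 0ℤ
coeff ((c , e' , w') ∷ f) e w with e' ≟ℤ e | w' ≟W w
... | yes _ | yes _ = c + coeff f e w
... | _     | _     = coeff f e w

_≈E_ : ∀ {r} → Elem r → Elem r → Set
f ≈E g = ∀ e w → coeff f e w ≡ coeff g e w

embed : ∀ {r} → ZComb r → Elem r
embed = map (λ { (c , w) → (c , 0ℤ , w) })

-- the element  p · u · g · v  (p scalar, u v biwords, g a relation)
IdealTerm : ℕ → Set
IdealTerm r = Laurent × Biword r × ZComb r × Biword r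

expand : ∀ {r} → IdealTerm r → Elem r
expand (p , u , g , v) =
  concatMap (λ { (c , e) → map (λ { (d , w) → (c * d , e , u ++ w ++ v) }) g }) p

termGen : ∀ {r} → IdealTerm r → ZComb r
termGen (p , u , g , v) = g

InIdeal : ∀ {r} → (ZComb r → Set) → Elem r → Set
InIdeal {r} IsGen f =
  Σ (List (IdealTerm r)) λ ts →
    All (λ t → IsGen (termGen t)) ts × (f ≈E concatMap expand ts)

rel : ∀ {r} → Biword r → Biword r → ZComb r
rel l s = (1ℤ , l) ∷ (- 1ℤ , s) ∷ []

-- 16·V(x,y,a,b) = (2a-2x-1)(2a-2y-1)(2b-2x-1)(2b-2y-1); same sign as V.
V16 : ∀ {r} → Fin r → Fin r → Fin r → Fin r → ℤ
V16 x y a b = f a x * f a y * f b x * f b y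
  where
  f : ∀ {r} → Fin r → Fin r → ℤ
  f s t = + (2 Data.Nat.* toℕ s) - + (2 Data.Nat.* toℕ t) - 1ℤ

IsGenSR : ∀ {r} → ZComb r → Set
IsGenSR {r} g =
  (Σ (Fin r) λ x → Σ (Fin r) λ y → Σ (Fin r) λ a →
     y < x × g ≡ rel (bw x y a a) (bw y x a a))
  ⊎
  (Σ (Fin r) λ x → Σ (Fin r) λ y → Σ (Fin r) λ a → Σ (Fin r) λ b →
     y < x × b < a ×
     g ≡ (1ℤ , bw x y a b) ∷ (- 1ℤ , bw y x b a) ∷ (- 1ℤ , bw y x a b) ∷ (1ℤ , bw x y b a) ∷ [])

IsGenSH : ∀ {r} → ZComb r → Set
IsGenSH {r} g =
  Σ (Fin r) λ x → Σ (Fin r) λ y → Σ (Fin r) λ a → Σ (Fin r) λ b →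
    y < x ×
    ((0ℤ ℤ.< V16 x y a b × g ≡ rel (bw x y a b) (bw y x a b))
     ⊎ (V16 x y a b ℤ.< 0ℤ × g ≡ rel (bw x y a b) (bw y x b a)))

{-# OPTIONS --safe #-}
-- Elements of the algebra are formal sums compared coefficientwise, so reordering a
-- sum (a permutation _↭_) does not change the element, and an ideal term p·u·g·v
-- depends linearly on g.  It therefore suffices to write each SR generator as a sum
-- of SH generators.  V(x,y,a,b) is symmetric in a and b and never zero, so for a > b
-- the four-term SR relation is
--   (xy/ab − yx/ab) + (xy/ba − yx/ba)   if V > 0,
--   (xy/ab − yx/ba) + (xy/ba − yx/ab)   if V < 0,
-- a sum of two SH relations; for a = b both SH relations coincide with the SR one.
module Submission where

open import Defs
open import Data.Nat using (ℕ; _≤_)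
open import Data.Fin using (Fin; _<_)
open import Data.Integer using (1ℤ; -_)
open import Data.List using (List; []; _∷_)
open import Data.Product using (_×_; _,_)

open import Algebra.Bundles using (CommutativeMonoid)
open import Data.Empty using (⊥-elim)
open import Data.Fin using (toℕ)
open import Data.Integer as ℤ using (ℤ; +_; _+_; _-_; _*_; 0ℤ)
import Data.Integer.Properties as ℤ
open import Data.Integer.Tactic.RingSolver using (solve-∀)
open import Data.List using ([_]; _++_; map; concat; concatMap)
open import Data.List.Properties using (map-++; map-cong; ++-identityʳ; concatMap-++)
open import Data.List.Relation.Binary.Permutation.Propositional
  using (_↭_; refl; prep; swap; trans; ↭-sym; ↭-reflexive)
open import Data.List.Relation.Binary.Permutation.Propositional.Properties
  using (++⁺; map⁺; shift; ++-commutativeMonoid)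
open import Data.List.Relation.Unary.All using (All; []; _∷_)
import Data.List.Relation.Unary.All.Properties as All
import Data.Nat as ℕ
import Data.Nat.Properties as ℕ
open import Data.Product using (Σ)
open import Data.Sum using (_⊎_; inj₁; inj₂)
import Data.Sum as Sum
open import Function using (_∘_)
open import Relation.Binary.Definitions using (tri<; tri≈; tri>)
open import Relation.Binary.PropositionalEquality using (_≡_; _≢_; cong; cong₂; sym; subst)
import Relation.Binary.PropositionalEquality as ≡
open ≡.≡-Reasoning
open import Relation.Nullary using (yes; no)

module _ {r : ℕ} where

  open import Algebra.Properties.CommutativeSemigroup
    (CommutativeMonoid.commutativeSemigroup (++-commutativeMonoid {A = ℤ × ℤ × Biword r}))
    using (interchange)
  open import Algebra.Properties.CommutativeSemigroup ℤ.+-commutativeSemigroup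
    using (x∙yz≈y∙xz)

  coeff-∷ : ∀ t (f : Elem r) e w → coeff (t ∷ f) e w ≡ coeff [ t ] e w + coeff f e w
  coeff-∷ (c , e′ , w′) f e w with e′ ℤ.≟ e | w′ ≟W w
  ... | yes _ | yes _ = cong (_+ coeff f e w) (sym (ℤ.+-identityʳ c))
  ... | yes _ | no _  = sym (ℤ.+-identityˡ _)
  ... | no _  | _     = sym (ℤ.+-identityˡ _)

  coeff-↭ : {f g : Elem r} → f ↭ g → f ≈E g
  coeff-↭ refl e w = ≡.refl
  coeff-↭ (prep {xs = f} {ys = g} t π) e w = begin
    coeff (t ∷ f) e w          ≡⟨ coeff-∷ t f e w ⟩
    c t + coeff f e w          ≡⟨ cong (λ z → c t + z) (coeff-↭ π e w) ⟩
    c t + coeff g e w          ≡⟨ coeff-∷ t g e w ⟨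
    coeff (t ∷ g) e w          ∎
    where c = λ t → coeff [ t ] e w
  coeff-↭ (swap {xs = f} {ys = g} s t π) e w = begin
    coeff (s ∷ t ∷ f) e w          ≡⟨ coeff-∷ s _ e w ⟩
    c s + coeff (t ∷ f) e w        ≡⟨ cong (λ z → c s + z) (coeff-∷ t f e w) ⟩
    c s + (c t + coeff f e w)      ≡⟨ cong (λ z → c s + (c t + z)) (coeff-↭ π e w) ⟩
    c s + (c t + coeff g e w)      ≡⟨ x∙yz≈y∙xz (c s) (c t) _ ⟩
    c t + (c s + coeff g e w)      ≡⟨ cong (λ z → c t + z) (coeff-∷ s g e w) ⟨
    c t + coeff (s ∷ g) e w        ≡⟨ coeff-∷ t _ e w ⟨
    coeff (t ∷ s ∷ g) e w          ∎
    where c = λ t → coeff [ t ] e w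
  coeff-↭ (trans π ρ) e w = ≡.trans (coeff-↭ π e w) (coeff-↭ ρ e w)

  expand-[] : ∀ p (u v : Biword r) → expand (p , u , [] , v) ≡ []
  expand-[] []            u v = ≡.refl
  expand-[] ((c , e) ∷ p) u v = expand-[] p u v

  expand-++ : ∀ p (u : Biword r) g h (v : Biword r) →
    expand (p , u , g ++ h , v) ↭ expand (p , u , g , v) ++ expand (p , u , h , v)
  expand-++ []            u g h v = refl
  expand-++ ((c , e) ∷ p) u g h v =
    trans (++⁺ (↭-reflexive (map-++ _ g h)) (expand-++ p u g h v)) (interchange (map _ g) (map _ h) _ _)

  expand-↭ : ∀ p (u v : Biword r) {g h} → g ↭ h → expand (p , u , g , v) ↭ expand (p , u , h , v)
  expand-↭ []            u v π = refl
  expand-↭ ((c , e) ∷ p) u v π = ++⁺ (map⁺ _ π) (expand-↭ p u v π)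

  expand-concat : ∀ p (u v : Biword r) gs →
    expand (p , u , concat gs , v) ↭ concatMap expand (map (λ g → p , u , g , v) gs)
  expand-concat p u v []       = ↭-reflexive (expand-[] p u v)
  expand-concat p u v (g ∷ gs) = trans (expand-++ p u g (concat gs) v) (++⁺ refl (expand-concat p u v gs))

  InIdeal-generator : ∀ {P : ZComb r → Set} {g} → P g → InIdeal P (embed g)
  InIdeal-generator {g = g} Pg =
    (unit , [] , g , []) ∷ [] , Pg ∷ [] , λ e w → cong (λ f → coeff f e w) embed≡expand
    where
    unit : Laurent
    unit = (1ℤ , 0ℤ) ∷ []
    embed≡expand : embed g ≡ concatMap expand ((unit , [] , g , []) ∷ [])
    embed≡expand = ≡.trans
      (map-cong (λ { (d , w) → cong₂ (λ c w′ → c , 0ℤ , w′) (sym (ℤ.*-identityˡ d)) (sym (++-identityʳ w)) }) g)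
      (sym (≡.trans (++-identityʳ _) (++-identityʳ _)))

  IsSumOf : (ZComb r → Set) → ZComb r → Set
  IsSumOf Q g = Σ (List (ZComb r)) λ gs → All Q gs × g ↭ concat gs

  IsSumOf-single : ∀ {Q : ZComb r → Set} {g} → Q g → IsSumOf Q g
  IsSumOf-single Qg = _ ∷ [] , Qg ∷ [] , ↭-sym (↭-reflexive (++-identityʳ _))

  module _ {P Q : ZComb r → Set} (decompose : ∀ {g} → P g → IsSumOf Q g) where

    split-terms : ∀ {ts} → All (P ∘ termGen) ts →
      Σ (List (IdealTerm r)) λ ts′ → All (Q ∘ termGen) ts′ × concatMap expand ts ↭ concatMap expand ts′
    split-terms [] = [] , [] , refl
    split-terms {(p , u , g , v) ∷ ts} (Pg ∷ Pts) with decompose Pg | split-terms Pts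
    ... | gs , Qgs , g↭gs | ts′ , Qts′ , ts↭ts′ =
      map (λ g′ → p , u , g′ , v) gs ++ ts′ ,
      All.++⁺ (All.map⁺ Qgs) Qts′ ,
      trans (++⁺ (trans (expand-↭ p u v g↭gs) (expand-concat p u v gs)) ts↭ts′)
            (↭-reflexive (sym (concatMap-++ expand (map _ gs) ts′)))

    InIdeal-mono : ∀ f → InIdeal P f → InIdeal Q f
    InIdeal-mono f (ts , Pts , f≈ts) with split-terms Pts
    ... | ts′ , Qts′ , ts↭ts′ = ts′ , Qts′ , λ e w → ≡.trans (f≈ts e w) (coeff-↭ ts↭ts′ e w)

i-j-1≡0⇒i≡1+j : ∀ i j → i - j - 1ℤ ≡ 0ℤ → i ≡ 1ℤ + j
i-j-1≡0⇒i≡1+j i j eq = begin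
  i           ≡⟨ i≡i-j+j i j ⟩
  i - j + j   ≡⟨ cong (λ k → k + j) (ℤ.i-j≡0⇒i≡j (i - j) 1ℤ eq) ⟩
  1ℤ + j      ∎
  where
  i≡i-j+j : ∀ i j → i ≡ i - j + j
  i≡i-j+j = solve-∀

*-≢0 : ∀ {i j} → i ≢ 0ℤ → j ≢ 0ℤ → i * j ≢ 0ℤ
*-≢0 {i} i≢0 j≢0 = Sum.[ i≢0 , j≢0 ] ∘ ℤ.i*j≡0⇒i≡0∨j≡0 i

-- V16 x y a b unfolds to  V16-factor a x * V16-factor a y * V16-factor b x * V16-factor b y.
V16-factor : ∀ {r} → Fin r → Fin r → ℤ
V16-factor s t = + (2 ℕ.* toℕ s) - + (2 ℕ.* toℕ t) - 1ℤ

V16-factor≢0 : ∀ {r} (s t : Fin r) → V16-factor s t ≢ 0ℤ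
V16-factor≢0 s t eq = ℕ.even≢odd (toℕ s) (toℕ t) (ℤ.+-injective (i-j-1≡0⇒i≡1+j _ (+ (2 ℕ.* toℕ t)) eq))

module _ {r : ℕ} (x y : Fin r) where

  V16≢0 : ∀ a b → V16 x y a b ≢ 0ℤ
  V16≢0 a b = *-≢0 (*-≢0 (*-≢0 (V16-factor≢0 a x) (V16-factor≢0 a y)) (V16-factor≢0 b x)) (V16-factor≢0 b y)

  V16-sign : ∀ a b → 0ℤ ℤ.< V16 x y a b ⊎ V16 x y a b ℤ.< 0ℤ
  V16-sign a b with ℤ.<-cmp (V16 x y a b) 0ℤ
  ... | tri< neg _ _  = inj₂ neg
  ... | tri≈ _ zero _ = ⊥-elim (V16≢0 a b zero)
  ... | tri> _ _ pos  = inj₁ pos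

  V16-swap : ∀ a b → V16 x y a b ≡ V16 x y b a
  V16-swap a b = swap-pairs (V16-factor a x) (V16-factor a y) (V16-factor b x) (V16-factor b y)
    where
    swap-pairs : ∀ i j k l → i * j * k * l ≡ k * l * i * j
    swap-pairs = solve-∀

IsGenSR⇒IsSumOf-IsGenSH : ∀ {r} {g : ZComb r} → IsGenSR g → IsSumOf IsGenSH g
IsGenSR⇒IsSumOf-IsGenSH (inj₁ (x , y , a , y<x , ≡.refl)) with V16-sign x y a a
... | inj₁ pos = IsSumOf-single (x , y , a , a , y<x , inj₁ (pos , ≡.refl))
... | inj₂ neg = IsSumOf-single (x , y , a , a , y<x , inj₂ (neg , ≡.refl))
IsGenSR⇒IsSumOf-IsGenSH (inj₂ (x , y , a , b , y<x , _ , ≡.refl))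
  with V16-sign x y a b | V16-swap x y a b
... | inj₁ pos | ab≡ba =
  rel (bw x y a b) (bw y x a b) ∷ rel (bw x y b a) (bw y x b a) ∷ [] ,
  (x , y , a , b , y<x , inj₁ (pos , ≡.refl)) ∷
  (x , y , b , a , y<x , inj₁ (subst (0ℤ ℤ.<_) ab≡ba pos , ≡.refl)) ∷ [] ,
  prep _ (↭-sym (shift _ (_ ∷ _ ∷ []) []))  -- moves the second summand to the end
... | inj₂ neg | ab≡ba =
  rel (bw x y a b) (bw y x b a) ∷ rel (bw x y b a) (bw y x a b) ∷ [] ,
  (x , y , a , b , y<x , inj₂ (neg , ≡.refl)) ∷
  (x , y , b , a , y<x , inj₂ (subst (ℤ._< 0ℤ) ab≡ba neg , ≡.refl)) ∷ [] ,
  prep _ (prep _ (swap _ _ refl))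

proposition5 : (r : ℕ) → 1 ≤ r →
    ((x y a : Fin r) → y < x →
      InIdeal IsGenSH (embed (rel (bw x y a a) (bw y x a a))))
    × ((x y a b : Fin r) → y < x → b < a →
      InIdeal IsGenSH (embed ((1ℤ , bw x y a b) ∷ (- 1ℤ , bw y x b a) ∷ (- 1ℤ , bw y x a b) ∷ (1ℤ , bw x y b a) ∷ [])))
    × ((f : Elem r) → InIdeal IsGenSR f → InIdeal IsGenSH f)
proposition5 r _ =
    (λ x y a y<x → SR-generator∈SH-ideal (inj₁ (x , y , a , y<x , ≡.refl)))
  , (λ x y a b y<x b<a → SR-generator∈SH-ideal (inj₂ (x , y , a , b , y<x , b<a , ≡.refl)))
  , SR-ideal⊆SH-ideal
  where
  SR-ideal⊆SH-ideal : (f : Elem r) → InIdeal IsGenSR f → InIdeal IsGenSH f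
  SR-ideal⊆SH-ideal = InIdeal-mono IsGenSR⇒IsSumOf-IsGenSH

  SR-generator∈SH-ideal : ∀ {g} → IsGenSR g → InIdeal IsGenSH (embed g)
  SR-generator∈SH-ideal {g} Pg = SR-ideal⊆SH-ideal (embed g) (InIdeal-generator Pg)
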